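{- Let $\Gamma$ be a finite multiset of $D$-formulas and let $G$ be a $G$-formula. Then $\Gamma \vdash_C G$ if and only if $G \supset \bot, \Gamma \vdash_I G$.
   Context: Formulas are those of a first-order language with logical symbols $\top,\bot,\land,\lor,\supset,\exists,\forall$; $\top$ and $\bot$ are not atomic. $[t/x]B$ is capture-avoiding substitution. A sequent $\Gamma\longrightarrow\Delta$ is a pair of finite multisets of formulas; $B,\Gamma$ denotes $\Gamma$ with one extra occurrence of $B$. A sequent is an axiom if $\top\in\Delta$, or some $A$ that is $\bot$ or atomic lies in both $\Gamma$ and $\Delta$. Inference rules (upper sequents $\Rightarrow$ lower sequent): contr-L: $B,B,\Gamma\longrightarrow\Delta \Rightarrow B,\Gamma\longrightarrow\Delta$; contr-R: $\Gamma\longrightarrow\Delta,B,B\Rightarrow\Gamma\longrightarrow\Delta,B$; $\bot$-R: $\Gamma\longrightarrow\Delta,\bot\Rightarrow\Gamma\longrightarrow\Delta,D$; $\land$-L: $B,D,B\land D,\Gamma\longrightarrow\Delta\Rightarrow B\land D,\Gamma\longrightarrow\Delta$; $\land$-R: $\Gamma\longrightarrow\Delta,B$ and $\Gamma\longrightarrow\Delta,D\Rightarrow\Gamma\longrightarrow\Delta,B\land D$; $\lor$-L: $B,\Gamma\longrightarrow\Delta$ and $D,\Gamma\longrightarrow\Delta\Rightarrow B\lor D,\Gamma\longrightarrow\Delta$; $\lor$-R: $\Gamma\longrightarrow\Delta,B$ (or $\Gamma\longrightarrow\Delta,D$) $\Rightarrow\Gamma\longrightarrow\Delta,B\lor D$;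 $\supset$-L: $B\supset D,\Gamma\longrightarrow B,\Delta$ and $D,\Gamma\longrightarrow\Theta\Rightarrow B\supset D,\Gamma\longrightarrow\Delta,\Theta$; $\supset$-R: $B,\Gamma\longrightarrow\Delta,D\Rightarrow\Gamma\longrightarrow\Delta,B\supset D$; $\forall$-L: $[t/x]B,\forall x B,\Gamma\longrightarrow\Delta\Rightarrow\forall xB,\Gamma\longrightarrow\Delta$; $\exists$-R: $\Gamma\longrightarrow\Delta,[t/x]B\Rightarrow\Gamma\longrightarrow\Delta,\exists xB$ ($t$ any term); $\exists$-L: $[c/x]B,\Gamma\longrightarrow\Delta\Rightarrow\exists xB,\Gamma\longrightarrow\Delta$ and $\forall$-R: $\Gamma\longrightarrow\Delta,[c/x]B\Rightarrow\Gamma\longrightarrow\Delta,\forall xB$, where the constant $c$ does not occur in the lower sequent. A C-proof is a finite derivation tree using these rules with axioms at the leaves; $\Gamma\vdash_C B$ means $\Gamma\longrightarrow B$ has a C-proof. An I-proof is a C-proof in which every sequent has exactly one succedent formula; $\Gamma\vdash_I B$ means $\Gamma\longrightarrow B$ has an I-proof. $G$-formulas and $D$-formulas are given by the grammar $G ::= \top \mid \bot \mid A \mid G\land G \mid G\lor G \mid D\supset G \mid \exists x\, G$ and $D ::= \top \mid \bot \mid A \mid G\supset D \mid D\land D \mid D\lor D \mid \exists x\, D \mid \forall x\, D$, with $A$ ranging over atomic formulas. -}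

module Defs where

open import Data.Nat using (ℕ; suc)
open import Data.Fin using (Fin; zero; suc)
open import Data.Vec using (Vec; []; _∷_)
open import Data.List using (List; []; _∷_; _++_; length)
open import Data.List.Membership.Propositional using (_∈_)
open import Data.List.Relation.Unary.All using (All)
open import Data.List.Relation.Binary.Permutation.Propositional using (_↭_)
open import Data.Product using (_×_)
open import Data.Unit using () renaming (⊤ to Unit)
open import Relation.Binary.PropositionalEquality using (_≡_; _≢_)

-- A first-order signature: function symbols and predicate symbols with arities.
-- In addition every language has an infinite supply of constants `con c`
-- (c : ℕ) that serve as eigenvariables.
record Signature : Set₁ where
  field
    Fun    : Set
    fArity : Fun → ℕ
    Pred   : Set
    pArity : Pred → ℕ

module Logic (S : Signature) where
  open Signature S

  -- Terms with n bound variables in scope (de Bruijn LEVELS: var zero is the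
  -- outermost binder).
  data Term (n : ℕ) : Set where
    var : Fin n → Term n
    con : ℕ → Term n
    app : (f : Fun) → Vec (Term n) (fArity f) → Term n

  data Fm (n : ℕ) : Set where
    atom : (p : Pred) → Vec (Term n) (pArity p) → Fm n
    `⊤ `⊥ : Fm n
    _`∧_ _`∨_ _`⊃_ : Fm n → Fm n → Fm n
    `∀ `∃ : Fm (suc n) → Fm n

  infixr 6 _`∧_
  infixr 5 _`∨_
  infixr 4 _`⊃_

  mutual
    embT : ∀ {n} → Term 0 → Term n
    embT (var ())
    embT (con c) = con c
    embT (app f ts) = app f (embTs ts)

    embTs : ∀ {n k} → Vec (Term 0) k → Vec (Term n) k
    embTs [] = []
    embTs (t ∷ ts) = embT t ∷ embTs ts

  mutual
    instT : ∀ {n} → Term 0 → Term (suc n) → Term n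
    instT t (var zero) = embT t
    instT t (var (suc i)) = var i
    instT t (con c) = con c
    instT t (app f ts) = app f (instTs t ts)

    instTs : ∀ {n k} → Term 0 → Vec (Term (suc n)) k → Vec (Term n) k
    instTs t [] = []
    instTs t (u ∷ us) = instT t u ∷ instTs t us

  instF : ∀ {n} → Term 0 → Fm (suc n) → Fm n
  instF t (atom p ts) = atom p (instTs t ts)
  instF t `⊤ = `⊤
  instF t `⊥ = `⊥
  instF t (A `∧ B) = instF t A `∧ instF t B
  instF t (A `∨ B) = instF t A `∨ instF t B
  instF t (A `⊃ B) = instF t A `⊃ instF t B
  instF t (`∀ B) = `∀ (instF t B)
  instF t (`∃ B) = `∃ (instF t B)

  [_/x]_ : Term 0 → Fm 1 → Fm 0
  [ t /x] B = instF t B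

  mutual
    NotInT : ∀ {n} → ℕ → Term n → Set
    NotInT c (var i) = Unit
    NotInT c (con d) = c ≢ d
    NotInT c (app f ts) = NotInTs c ts

    NotInTs : ∀ {n k} → ℕ → Vec (Term n) k → Set
    NotInTs c [] = Unit
    NotInTs c (t ∷ ts) = NotInT c t × NotInTs c ts

  NotInF : ∀ {n} → ℕ → Fm n → Set
  NotInF c (atom p ts) = NotInTs c ts
  NotInF c `⊤ = Unit
  NotInF c `⊥ = Unit
  NotInF c (A `∧ B) = NotInF c A × NotInF c B
  NotInF c (A `∨ B) = NotInF c A × NotInF c B
  NotInF c (A `⊃ B) = NotInF c A × NotInF c B
  NotInF c (`∀ B) = NotInF c B
  NotInF c (`∃ B) = NotInF c B

  Fresh : ℕ → List (Fm 0) → List (Fm 0) → Set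
  Fresh c Γ Δ = All (NotInF c) Γ × All (NotInF c) Δ

  data AtomOr⊥ {n : ℕ} : Fm n → Set where
    isAtom : ∀ p ts → AtomOr⊥ (atom p ts)
    is⊥    : AtomOr⊥ `⊥

  mutual
    data IsG {n : ℕ} : Fm n → Set where
      g⊤ : IsG `⊤
      g⊥ : IsG `⊥
      gA : ∀ p ts → IsG (atom p ts)
      g∧ : ∀ {A B} → IsG A → IsG B → IsG (A `∧ B)
      g∨ : ∀ {A B} → IsG A → IsG B → IsG (A `∨ B)
      g⊃ : ∀ {A B} → IsD A → IsG B → IsG (A `⊃ B)
      g∃ : ∀ {B} → IsG B → IsG (`∃ B)

    data IsD {n : ℕ} : Fm n → Set where
      d⊤ : IsD `⊤
      d⊥ : IsD `⊥
      dA : ∀ p ts → IsD (atom p ts)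
      d⊃ : ∀ {A B} → IsG A → IsD B → IsD (A `⊃ B)
      d∧ : ∀ {A B} → IsD A → IsD B → IsD (A `∧ B)
      d∨ : ∀ {A B} → IsD A → IsD B → IsD (A `∨ B)
      d∃ : ∀ {B} → IsD B → IsD (`∃ B)
      d∀ : ∀ {B} → IsD B → IsD (`∀ B)

  -- Sequents Γ ⟶ Δ over closed formulas. Multisets are represented by lists
  -- taken up to permutation (rule `exch`); principal formulas are written at
  -- the head of the list.
  infix 2 _⟶_
  data _⟶_ : List (Fm 0) → List (Fm 0) → Set where
    ax⊤    : ∀ {Γ Δ} → `⊤ ∈ Δ → Γ ⟶ Δ
    axA    : ∀ {Γ Δ A} → AtomOr⊥ A → A ∈ Γ → A ∈ Δ → Γ ⟶ Δ
    exch   : ∀ {Γ Γ' Δ Δ'} → Γ ↭ Γ' → Δ ↭ Δ' → Γ ⟶ Δ → Γ' ⟶ Δ'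
    contrL : ∀ {Γ Δ B} → B ∷ B ∷ Γ ⟶ Δ → B ∷ Γ ⟶ Δ
    contrR : ∀ {Γ Δ B} → Γ ⟶ B ∷ B ∷ Δ → Γ ⟶ B ∷ Δ
    ⊥R     : ∀ {Γ Δ D} → Γ ⟶ `⊥ ∷ Δ → Γ ⟶ D ∷ Δ
    ∧L     : ∀ {Γ Δ B D} → B ∷ D ∷ (B `∧ D) ∷ Γ ⟶ Δ → (B `∧ D) ∷ Γ ⟶ Δ
    ∧R     : ∀ {Γ Δ B D} → Γ ⟶ B ∷ Δ → Γ ⟶ D ∷ Δ → Γ ⟶ (B `∧ D) ∷ Δ
    ∨L     : ∀ {Γ Δ B D} → B ∷ Γ ⟶ Δ → D ∷ Γ ⟶ Δ → (B `∨ D) ∷ Γ ⟶ Δ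
    ∨R₁    : ∀ {Γ Δ B D} → Γ ⟶ B ∷ Δ → Γ ⟶ (B `∨ D) ∷ Δ
    ∨R₂    : ∀ {Γ Δ B D} → Γ ⟶ D ∷ Δ → Γ ⟶ (B `∨ D) ∷ Δ
    ⊃L     : ∀ {Γ Δ Θ B D} → (B `⊃ D) ∷ Γ ⟶ B ∷ Δ → D ∷ Γ ⟶ Θ
             → (B `⊃ D) ∷ Γ ⟶ Δ ++ Θ
    ⊃R     : ∀ {Γ Δ B D} → B ∷ Γ ⟶ D ∷ Δ → Γ ⟶ (B `⊃ D) ∷ Δ
    ∀L     : ∀ {Γ Δ B} (t : Term 0) → ([ t /x] B) ∷ `∀ B ∷ Γ ⟶ Δ → `∀ B ∷ Γ ⟶ Δ
    ∃R     : ∀ {Γ Δ B} (t : Term 0) → Γ ⟶ ([ t /x] B) ∷ Δ → Γ ⟶ `∃ B ∷ Δ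
    ∃L     : ∀ {Γ Δ B} (c : ℕ) → Fresh c (`∃ B ∷ Γ) Δ
             → ([ con c /x] B) ∷ Γ ⟶ Δ → `∃ B ∷ Γ ⟶ Δ
    ∀R     : ∀ {Γ Δ B} (c : ℕ) → Fresh c Γ (`∀ B ∷ Δ)
             → Γ ⟶ ([ con c /x] B) ∷ Δ → Γ ⟶ `∀ B ∷ Δ

  IsI : ∀ {Γ Δ} → Γ ⟶ Δ → Set
  IsI {Γ} {Δ} p = length Δ ≡ 1 × below p
    where
    below : ∀ {Γ Δ} → Γ ⟶ Δ → Set
    below (ax⊤ _) = Unit
    below (axA _ _ _) = Unit
    below (exch _ _ q) = IsI q
    below (contrL q) = IsI q
    below (contrR q) = IsI q
    below (⊥R q) = IsI q
    below (∧L q) = IsI q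
    below (∧R q r) = IsI q × IsI r
    below (∨L q r) = IsI q × IsI r
    below (∨R₁ q) = IsI q
    below (∨R₂ q) = IsI q
    below (⊃L q r) = IsI q × IsI r
    below (⊃R q) = IsI q
    below (∀L _ q) = IsI q
    below (∃R _ q) = IsI q
    below (∃L _ _ q) = IsI q
    below (∀R _ _ q) = IsI q

  _⊢C_ : List (Fm 0) → Fm 0 → Set
  Γ ⊢C B = Γ ⟶ B ∷ []

  _⊢I_ : List (Fm 0) → Fm 0 → Set
  Γ ⊢I B = Data.Product.Σ (Γ ⟶ B ∷ []) IsI

-- Classical to intuitionistic: read a C-proof of Π ⟶ Δ as a statement about the contexts C of
-- an intuitionistic calculus: if C contains Π and refutes every formula of Δ (every extension of
-- C in which the formula is provable is inconsistent), then C is inconsistent.  Every rule is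
-- sound for this reading except ∀R, and the G/D discipline keeps ∀ out of every succedent.  As
-- G ⊃ ⊥ refutes G, the context G ⊃ ⊥, Γ is inconsistent, so in particular it proves G.
-- Intuitionistic to classical: in a proof of G ⊃ ⊥, Γ ⟶ G the hypothesis G ⊃ ⊥ can only be used
-- by ⊃L, whose left premise has G in its succedent, where G already is; so it can be discharged.
module Submission where

open import Defs
open import Data.Nat using (ℕ; suc; _⊔_; _<_)
open import Data.Nat.Properties using (_≟_; <-irrefl; ≤-refl; m⊔n<o⇒m<o; m⊔n<o⇒n<o)
open import Data.Fin using (zero; suc)
open import Data.Vec using (Vec; []; _∷_)
open import Data.List using (List; []; _∷_; _++_)
open import Data.List.Membership.Propositional using (_∈_)
open import Data.List.Membership.Propositional.Properties using (∈-∃++; ∈-++⁺ˡ)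
open import Data.List.Properties using (++-identityʳ)
open import Data.List.Relation.Unary.Any using (here; there)
open import Data.List.Relation.Unary.All as All using (All; []; _∷_)
open import Data.List.Relation.Unary.All.Properties using (++⁻ˡ; ++⁻ʳ)
open import Data.List.Relation.Binary.Subset.Propositional using (_⊆_)
open import Data.List.Relation.Binary.Subset.Propositional.Properties using (⊆-refl; ⊆-trans; ∷⁺ʳ)
open import Data.List.Relation.Binary.Permutation.Propositional using (_↭_; prep; ↭-refl; ↭-sym)
open import Data.List.Relation.Binary.Permutation.Propositional.Properties using (shift; All-resp-↭)
open import Data.Product using (∃; _,_; proj₂)
open import Data.Unit using (tt)
open import Function using (id; _∘_)
open import Function.Bundles using (_⇔_; mk⇔)
open import Data.Empty using (⊥-elim)
open import Relation.Nullary using (yes; no)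
open import Relation.Binary.PropositionalEquality
  using (_≡_; _≢_; refl; sym; cong; cong₂; subst; module ≡-Reasoning)

module Glivenko (S : Signature) where
  open Logic S

  private variable
    n : ℕ
    c : ℕ
    A A' B D F N Y : Fm 0
    Γ Δ Δ' Π C C' : List (Fm 0)

  -- Renaming constants

  Ren : Set
  Ren = ℕ → ℕ

  mutual
    renT : Ren → Term n → Term n
    renT σ (var i) = var i
    renT σ (con d) = con (σ d)
    renT σ (app f ts) = app f (renTs σ ts)

    renTs : ∀ {k} → Ren → Vec (Term n) k → Vec (Term n) k
    renTs σ [] = []
    renTs σ (t ∷ ts) = renT σ t ∷ renTs σ ts

  renF : Ren → Fm n → Fm n
  renF σ (atom p ts) = atom p (renTs σ ts)
  renF σ `⊤ = `⊤
  renF σ `⊥ = `⊥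
  renF σ (A `∧ B) = renF σ A `∧ renF σ B
  renF σ (A `∨ B) = renF σ A `∨ renF σ B
  renF σ (A `⊃ B) = renF σ A `⊃ renF σ B
  renF σ (`∀ B) = `∀ (renF σ B)
  renF σ (`∃ B) = `∃ (renF σ B)

  mutual
    renT-embT : ∀ σ (t : Term 0) → renT {n} σ (embT t) ≡ embT (renT σ t)
    renT-embT σ (var ())
    renT-embT σ (con d) = refl
    renT-embT σ (app f ts) = cong (app f) (renTs-embTs σ ts)

    renTs-embTs : ∀ {k} σ (ts : Vec (Term 0) k) → renTs {n} σ (embTs ts) ≡ embTs (renTs σ ts)
    renTs-embTs σ [] = refl
    renTs-embTs σ (t ∷ ts) = cong₂ _∷_ (renT-embT σ t) (renTs-embTs σ ts)

  mutual
    renT-instT : ∀ σ (t : Term 0) (u : Term (suc n)) → renT σ (instT t u) ≡ instT (renT σ t) (renT σ u)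
    renT-instT σ t (var zero) = renT-embT σ t
    renT-instT σ t (var (suc i)) = refl
    renT-instT σ t (con d) = refl
    renT-instT σ t (app f us) = cong (app f) (renTs-instTs σ t us)

    renTs-instTs : ∀ {k} σ (t : Term 0) (us : Vec (Term (suc n)) k)
                 → renTs σ (instTs t us) ≡ instTs (renT σ t) (renTs σ us)
    renTs-instTs σ t [] = refl
    renTs-instTs σ t (u ∷ us) = cong₂ _∷_ (renT-instT σ t u) (renTs-instTs σ t us)

  renF-instF : ∀ σ (t : Term 0) (B : Fm (suc n)) → renF σ (instF t B) ≡ instF (renT σ t) (renF σ B)
  renF-instF σ t (atom p ts) = cong (atom p) (renTs-instTs σ t ts)
  renF-instF σ t `⊤ = refl
  renF-instF σ t `⊥ = refl
  renF-instF σ t (A `∧ B) = cong₂ _`∧_ (renF-instF σ t A) (renF-instF σ t B)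
  renF-instF σ t (A `∨ B) = cong₂ _`∨_ (renF-instF σ t A) (renF-instF σ t B)
  renF-instF σ t (A `⊃ B) = cong₂ _`⊃_ (renF-instF σ t A) (renF-instF σ t B)
  renF-instF σ t (`∀ B) = cong `∀ (renF-instF σ t B)
  renF-instF σ t (`∃ B) = cong `∃ (renF-instF σ t B)

  mutual
    renT-id : (u : Term n) → renT id u ≡ u
    renT-id (var i) = refl
    renT-id (con d) = refl
    renT-id (app f ts) = cong (app f) (renTs-id ts)

    renTs-id : ∀ {k} (us : Vec (Term n) k) → renTs id us ≡ us
    renTs-id [] = refl
    renTs-id (u ∷ us) = cong₂ _∷_ (renT-id u) (renTs-id us)

  renF-id : (A : Fm n) → renF id A ≡ A
  renF-id (atom p ts) = cong (atom p) (renTs-id ts)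
  renF-id `⊤ = refl
  renF-id `⊥ = refl
  renF-id (A `∧ B) = cong₂ _`∧_ (renF-id A) (renF-id B)
  renF-id (A `∨ B) = cong₂ _`∨_ (renF-id A) (renF-id B)
  renF-id (A `⊃ B) = cong₂ _`⊃_ (renF-id A) (renF-id B)
  renF-id (`∀ B) = cong `∀ (renF-id B)
  renF-id (`∃ B) = cong `∃ (renF-id B)

  All-renF-id : (P : Fm 0 → Set) → All P Π → All (P ∘ renF id) Π
  All-renF-id P = All.map λ {A} → subst P (sym (renF-id A))

  AtomOr⊥-renF : ∀ σ → AtomOr⊥ A → AtomOr⊥ (renF σ A)
  AtomOr⊥-renF σ (isAtom p ts) = isAtom p _
  AtomOr⊥-renF σ is⊥ = is⊥

  _[_↦_] : Ren → ℕ → ℕ → Ren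
  (σ [ c ↦ c' ]) d with d ≟ c
  ... | yes _ = c'
  ... | no _ = σ d

  ↦-same : ∀ σ c c' → (σ [ c ↦ c' ]) c ≡ c'
  ↦-same σ c c' with c ≟ c
  ... | yes _ = refl
  ... | no c≢c = ⊥-elim (c≢c refl)

  ↦-other : ∀ σ {c} c' d → c ≢ d → (σ [ c ↦ c' ]) d ≡ σ d
  ↦-other σ {c} c' d c≢d with d ≟ c
  ... | yes d≡c = ⊥-elim (c≢d (sym d≡c))
  ... | no _ = refl

  mutual
    renT-↦-fresh : ∀ σ {c} c' (u : Term n) → NotInT c u → renT (σ [ c ↦ c' ]) u ≡ renT σ u
    renT-↦-fresh σ c' (var i) _ = refl
    renT-↦-fresh σ c' (con d) c≢d = cong con (↦-other σ c' d c≢d)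
    renT-↦-fresh σ c' (app f ts) fr = cong (app f) (renTs-↦-fresh σ c' ts fr)

    renTs-↦-fresh : ∀ {k} σ {c} c' (us : Vec (Term n) k) → NotInTs c us
                  → renTs (σ [ c ↦ c' ]) us ≡ renTs σ us
    renTs-↦-fresh σ c' [] _ = refl
    renTs-↦-fresh σ c' (u ∷ us) (fr , frs) =
      cong₂ _∷_ (renT-↦-fresh σ c' u fr) (renTs-↦-fresh σ c' us frs)

  renF-↦-fresh : ∀ σ {c} c' (A : Fm n) → NotInF c A → renF (σ [ c ↦ c' ]) A ≡ renF σ A
  renF-↦-fresh σ c' (atom p ts) fr = cong (atom p) (renTs-↦-fresh σ c' ts fr)
  renF-↦-fresh σ c' `⊤ _ = refl
  renF-↦-fresh σ c' `⊥ _ = refl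
  renF-↦-fresh σ c' (A `∧ B) (frA , frB) =
    cong₂ _`∧_ (renF-↦-fresh σ c' A frA) (renF-↦-fresh σ c' B frB)
  renF-↦-fresh σ c' (A `∨ B) (frA , frB) =
    cong₂ _`∨_ (renF-↦-fresh σ c' A frA) (renF-↦-fresh σ c' B frB)
  renF-↦-fresh σ c' (A `⊃ B) (frA , frB) =
    cong₂ _`⊃_ (renF-↦-fresh σ c' A frA) (renF-↦-fresh σ c' B frB)
  renF-↦-fresh σ c' (`∀ B) fr = cong `∀ (renF-↦-fresh σ c' B fr)
  renF-↦-fresh σ c' (`∃ B) fr = cong `∃ (renF-↦-fresh σ c' B fr)

  All-renF-↦-fresh : (P : Fm 0 → Set) → ∀ σ {c} c' → All (NotInF c) Π → All (P ∘ renF σ) Π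
                   → All (P ∘ renF (σ [ c ↦ c' ])) Π
  All-renF-↦-fresh P σ c' [] [] = []
  All-renF-↦-fresh P σ c' (fr ∷ frs) (p ∷ ps) =
    subst P (sym (renF-↦-fresh σ c' _ fr)) p ∷ All-renF-↦-fresh P σ c' frs ps

  renF-eigen : ∀ σ {c} c' (B : Fm 1) → NotInF c B
             → renF (σ [ c ↦ c' ]) ([ con c /x] B) ≡ [ con c' /x] renF σ B
  renF-eigen σ {c} c' B fr = begin
    renF σ' (instF (con c) B)         ≡⟨ renF-instF σ' (con c) B ⟩
    instF (con (σ' c)) (renF σ' B)    ≡⟨ cong₂ (instF ∘ con) (↦-same σ c c') (renF-↦-fresh σ c' B fr) ⟩
    instF (con c') (renF σ B)         ∎
    where
    open ≡-Reasoning
    σ' = σ [ c ↦ c' ]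

  mutual
    maxConT : Term n → ℕ
    maxConT (var i) = 0
    maxConT (con d) = d
    maxConT (app f ts) = maxConTs ts

    maxConTs : ∀ {k} → Vec (Term n) k → ℕ
    maxConTs [] = 0
    maxConTs (t ∷ ts) = maxConT t ⊔ maxConTs ts

  maxConF : Fm n → ℕ
  maxConF (atom p ts) = maxConTs ts
  maxConF `⊤ = 0
  maxConF `⊥ = 0
  maxConF (A `∧ B) = maxConF A ⊔ maxConF B
  maxConF (A `∨ B) = maxConF A ⊔ maxConF B
  maxConF (A `⊃ B) = maxConF A ⊔ maxConF B
  maxConF (`∀ B) = maxConF B
  maxConF (`∃ B) = maxConF B

  maxConL : List (Fm 0) → ℕ
  maxConL [] = 0
  maxConL (A ∷ As) = maxConF A ⊔ maxConL As

  mutual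
    >maxConT⇒NotInT : (u : Term n) → maxConT u < c → NotInT c u
    >maxConT⇒NotInT (var i) _ = tt
    >maxConT⇒NotInT (con d) d<c refl = <-irrefl refl d<c
    >maxConT⇒NotInT (app f ts) lt = >maxConTs⇒NotInTs ts lt

    >maxConTs⇒NotInTs : ∀ {k} (us : Vec (Term n) k) → maxConTs us < c → NotInTs c us
    >maxConTs⇒NotInTs [] _ = tt
    >maxConTs⇒NotInTs (u ∷ us) lt =
      >maxConT⇒NotInT u (m⊔n<o⇒m<o _ _ lt) , >maxConTs⇒NotInTs us (m⊔n<o⇒n<o _ _ lt)

  >maxConF⇒NotInF : (A : Fm n) → maxConF A < c → NotInF c A
  >maxConF⇒NotInF (atom p ts) lt = >maxConTs⇒NotInTs ts lt
  >maxConF⇒NotInF `⊤ _ = tt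
  >maxConF⇒NotInF `⊥ _ = tt
  >maxConF⇒NotInF (A `∧ B) lt =
    >maxConF⇒NotInF A (m⊔n<o⇒m<o _ _ lt) , >maxConF⇒NotInF B (m⊔n<o⇒n<o _ _ lt)
  >maxConF⇒NotInF (A `∨ B) lt =
    >maxConF⇒NotInF A (m⊔n<o⇒m<o _ _ lt) , >maxConF⇒NotInF B (m⊔n<o⇒n<o _ _ lt)
  >maxConF⇒NotInF (A `⊃ B) lt =
    >maxConF⇒NotInF A (m⊔n<o⇒m<o _ _ lt) , >maxConF⇒NotInF B (m⊔n<o⇒n<o _ _ lt)
  >maxConF⇒NotInF (`∀ B) lt = >maxConF⇒NotInF B lt
  >maxConF⇒NotInF (`∃ B) lt = >maxConF⇒NotInF B lt

  >maxConL⇒NotIn : (As : List (Fm 0)) → maxConL As < c → All (NotInF c) As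
  >maxConL⇒NotIn [] _ = []
  >maxConL⇒NotIn (A ∷ As) lt =
    >maxConF⇒NotInF A (m⊔n<o⇒m<o _ _ lt) ∷ >maxConL⇒NotIn As (m⊔n<o⇒n<o _ _ lt)

  fresh : (Γ Δ : List (Fm 0)) → ∃ λ c → Fresh c Γ Δ
  fresh Γ Δ = suc (maxConL Γ ⊔ maxConL Δ)
            , >maxConL⇒NotIn Γ (m⊔n<o⇒m<o _ _ ≤-refl) , >maxConL⇒NotIn Δ (m⊔n<o⇒n<o _ _ ≤-refl)

  Fresh-∷ˡ : A ∈ Γ → Fresh c Γ Δ → Fresh c (A ∷ Γ) Δ
  Fresh-∷ˡ m (frΓ , frΔ) = All.lookup frΓ m ∷ frΓ , frΔ

  Fresh-∷ʳ : A ∈ Δ → Fresh c Γ Δ → Fresh c Γ (A ∷ Δ)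
  Fresh-∷ʳ m (frΓ , frΔ) = frΓ , All.lookup frΔ m ∷ frΔ

  mutual
    IsG-instF : ∀ (t : Term 0) {B : Fm (suc n)} → IsG B → IsG (instF t B)
    IsG-instF t g⊤ = g⊤
    IsG-instF t g⊥ = g⊥
    IsG-instF t (gA p ts) = gA p _
    IsG-instF t (g∧ g h) = g∧ (IsG-instF t g) (IsG-instF t h)
    IsG-instF t (g∨ g h) = g∨ (IsG-instF t g) (IsG-instF t h)
    IsG-instF t (g⊃ d h) = g⊃ (IsD-instF t d) (IsG-instF t h)
    IsG-instF t (g∃ h) = g∃ (IsG-instF t h)

    IsD-instF : ∀ (t : Term 0) {B : Fm (suc n)} → IsD B → IsD (instF t B)
    IsD-instF t d⊤ = d⊤
    IsD-instF t d⊥ = d⊥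
    IsD-instF t (dA p ts) = dA p _
    IsD-instF t (d⊃ g e) = d⊃ (IsG-instF t g) (IsD-instF t e)
    IsD-instF t (d∧ d e) = d∧ (IsD-instF t d) (IsD-instF t e)
    IsD-instF t (d∨ d e) = d∨ (IsD-instF t d) (IsD-instF t e)
    IsD-instF t (d∃ e) = d∃ (IsD-instF t e)
    IsD-instF t (d∀ e) = d∀ (IsD-instF t e)

  ↭-front : A ∈ Γ → ∃ λ Γ₀ → Γ ↭ A ∷ Γ₀
  ↭-front {A} m with ∈-∃++ m
  ... | xs , ys , refl = xs ++ ys , shift A xs ys

  at-front : A ∈ Γ → (∀ {Γ₀} → Γ ↭ A ∷ Γ₀ → A ∷ Γ₀ ⟶ Δ) → Γ ⟶ Δ
  at-front m rule = exch (↭-sym π) ↭-refl (rule π)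
    where π = proj₂ (↭-front m)

  contractL-∈ : A ∈ Γ → A ∷ Γ ⟶ Δ → Γ ⟶ Δ
  contractL-∈ m p = at-front m λ π → contrL (exch (prep _ π) ↭-refl p)

  contractR-∈ : A ∈ Δ → Γ ⟶ A ∷ Δ → Γ ⟶ Δ
  contractR-∈ m p = exch ↭-refl (↭-sym π) (contrR (exch ↭-refl (prep _ π) p))
    where π = proj₂ (↭-front m)

  contractR-⊆ : ∀ Ξ → Ξ ⊆ Δ → Γ ⟶ Δ ++ Ξ → Γ ⟶ Δ
  contractR-⊆ {Δ} {Γ} [] _ p = subst (Γ ⟶_) (++-identityʳ Δ) p
  contractR-⊆ {Δ} (A ∷ Ξ) sub p =
    contractR-⊆ Ξ (sub ∘ there) (contractR-∈ (∈-++⁺ˡ (sub (here refl))) (exch ↭-refl (shift A Δ Ξ) p))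

  -- The renaming σ lets eigenvariables of a proof be replaced by constants fresh for the larger
  -- contexts it is embedded into.
  infix 4 _⊆[_]_
  _⊆[_]_ : List (Fm 0) → Ren → List (Fm 0) → Set
  Π ⊆[ σ ] C = All ((_∈ C) ∘ renF σ) Π

  ⊆[]-mono : ∀ {σ} → C ⊆ C' → Π ⊆[ σ ] C → Π ⊆[ σ ] C'
  ⊆[]-mono sub = All.map sub

  ⊆[]-∷⁺ : ∀ {σ} → renF σ A ≡ A' → Π ⊆[ σ ] C → A ∷ Π ⊆[ σ ] A' ∷ C
  ⊆[]-∷⁺ eq mem = here eq ∷ ⊆[]-mono there mem

  ⊆[]-∷⁺-behind : ∀ {σ} → renF σ A ≡ A' → Π ⊆[ σ ] N ∷ C → A ∷ Π ⊆[ σ ] N ∷ A' ∷ C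
  ⊆[]-∷⁺-behind eq mem = there (here eq) ∷ ⊆[]-mono (∷⁺ʳ _ there) mem

  AtomOr⊥-∈-∷⊃ : AtomOr⊥ A → A ∈ (B `⊃ D) ∷ Γ → A ∈ Γ
  AtomOr⊥-∈-∷⊃ (isAtom p ts) (there m) = m
  AtomOr⊥-∈-∷⊃ is⊥ (there m) = m

  discharge : Π ⟶ Δ → ∀ σ → Π ⊆[ σ ] (A `⊃ B) ∷ Γ → Δ ⊆[ σ ] Δ' → A ∈ Δ' → Γ ⟶ Δ'
  discharge (ax⊤ m) σ _ md _ = ax⊤ (All.lookup md m)
  discharge (axA a m₁ m₂) σ mem md _ =
    axA a' (AtomOr⊥-∈-∷⊃ a' (All.lookup mem m₁)) (All.lookup md m₂)
    where a' = AtomOr⊥-renF σ a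
  discharge (exch π₁ π₂ p) σ mem md a =
    discharge p σ (All-resp-↭ (↭-sym π₁) mem) (All-resp-↭ (↭-sym π₂) md) a
  discharge (contrL p) σ (m ∷ mem) md a = discharge p σ (m ∷ m ∷ mem) md a
  discharge (contrR p) σ mem (m ∷ md) a = discharge p σ mem (m ∷ m ∷ md) a
  discharge (⊥R p) σ mem (m ∷ md) a = contractR-∈ m (⊥R (discharge p σ mem (⊆[]-∷⁺ refl md) (there a)))
  discharge (∧L p) σ (here () ∷ _) _ _
  discharge (∧L p) σ (there m ∷ mem) md a =
    contractL-∈ m (∧L (discharge p σ mem' md a))
    where mem' = ⊆[]-∷⁺-behind refl (⊆[]-∷⁺-behind refl (⊆[]-∷⁺-behind refl mem))
  discharge (∧R p q) σ mem (m ∷ md) a =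
    contractR-∈ m (∧R (discharge p σ mem (⊆[]-∷⁺ refl md) (there a))
                       (discharge q σ mem (⊆[]-∷⁺ refl md) (there a)))
  discharge (∨L p q) σ (here () ∷ _) _ _
  discharge (∨L p q) σ (there m ∷ mem) md a =
    contractL-∈ m (∨L (discharge p σ (⊆[]-∷⁺-behind refl mem) md a)
                       (discharge q σ (⊆[]-∷⁺-behind refl mem) md a))
  discharge (∨R₁ p) σ mem (m ∷ md) a = contractR-∈ m (∨R₁ (discharge p σ mem (⊆[]-∷⁺ refl md) (there a)))
  discharge (∨R₂ p) σ mem (m ∷ md) a = contractR-∈ m (∨R₂ (discharge p σ mem (⊆[]-∷⁺ refl md) (there a)))
  discharge (⊃L {Δ = Δ₁} p q) σ (here refl ∷ mem) md a =
    discharge p σ (here refl ∷ mem) (a ∷ ++⁻ˡ Δ₁ md) a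
  discharge (⊃L {Δ = Δ₁} p q) σ (there m ∷ mem) md a =
    contractL-∈ m (contractR-⊆ _ ⊆-refl (⊃L
      (discharge p σ (⊆[]-∷⁺-behind refl mem) (⊆[]-∷⁺ refl (++⁻ˡ Δ₁ md)) (there a))
      (discharge q σ (⊆[]-∷⁺-behind refl mem) (++⁻ʳ Δ₁ md) a)))
  discharge (⊃R p) σ mem (m ∷ md) a =
    contractR-∈ m (⊃R (discharge p σ (⊆[]-∷⁺-behind refl mem) (⊆[]-∷⁺ refl md) (there a)))
  discharge (∀L t p) σ (here () ∷ _) _ _
  discharge (∀L {B = B} t p) σ (there m ∷ mem) md a =
    contractL-∈ m (∀L (renT σ t)
      (discharge p σ (⊆[]-∷⁺-behind (renF-instF σ t B) (⊆[]-∷⁺-behind refl mem)) md a))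
  discharge (∃R {B = B} t p) σ mem (m ∷ md) a =
    contractR-∈ m (∃R (renT σ t) (discharge p σ mem (⊆[]-∷⁺ (renF-instF σ t B) md) (there a)))
  discharge (∃L c fr p) σ (here () ∷ _) _ _
  discharge {Γ = Γ} {Δ' = Δ'} (∃L {B = B} c (frB ∷ frΓ₀ , frΔ) p) σ (there m ∷ mem) md a
    with fresh Γ Δ'
  ... | c' , fr' =
    contractL-∈ m (∃L c' (Fresh-∷ˡ m fr') (discharge p (σ [ c ↦ c' ])
      (⊆[]-∷⁺-behind (renF-eigen σ c' B frB) (All-renF-↦-fresh (_∈ _) σ c' frΓ₀ mem))
      (All-renF-↦-fresh (_∈ _) σ c' frΔ md) a))
  discharge {Γ = Γ} {Δ' = Δ'} (∀R {B = B} c (frΠ , frB ∷ frΔ) p) σ mem (m ∷ md) a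
    with fresh Γ Δ'
  ... | c' , fr' =
    contractR-∈ m (∀R c' (Fresh-∷ʳ m fr') (discharge p (σ [ c ↦ c' ])
      (All-renF-↦-fresh (_∈ _) σ c' frΠ mem)
      (⊆[]-∷⁺ (renF-eigen σ c' B frB) (All-renF-↦-fresh (_∈ _) σ c' frΔ md)) (there a)))

  -- An intuitionistic calculus with shared contexts

  infix 2 _⊢_
  data _⊢_ : List (Fm 0) → Fm 0 → Set where
    iax⊤ : C ⊢ `⊤
    iaxA : AtomOr⊥ A → A ∈ C → C ⊢ A
    i⊥R  : C ⊢ `⊥ → C ⊢ Y
    i∧L  : (A `∧ B) ∈ C → A ∷ B ∷ C ⊢ Y → C ⊢ Y
    i∧R  : C ⊢ A → C ⊢ B → C ⊢ A `∧ B
    i∨L  : (A `∨ B) ∈ C → A ∷ C ⊢ Y → B ∷ C ⊢ Y → C ⊢ Y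
    i∨R₁ : C ⊢ A → C ⊢ A `∨ B
    i∨R₂ : C ⊢ B → C ⊢ A `∨ B
    i⊃L  : (A `⊃ B) ∈ C → (A `⊃ B) ∷ C ⊢ A → B ∷ C ⊢ Y → C ⊢ Y
    i⊃R  : A ∷ C ⊢ B → C ⊢ A `⊃ B
    i∀L  : ∀ {B} (t : Term 0) → `∀ B ∈ C → [ t /x] B ∷ C ⊢ Y → C ⊢ Y
    i∃R  : ∀ {B} (t : Term 0) → C ⊢ [ t /x] B → C ⊢ `∃ B
    i∃L  : ∀ {B} (c : ℕ) → `∃ B ∈ C → Fresh c C (Y ∷ []) → [ con c /x] B ∷ C ⊢ Y → C ⊢ Y

  ⊢⇒⟶ : C ⊢ Y → C ⟶ Y ∷ []
  ⊢⇒⟶ iax⊤ = ax⊤ (here refl)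
  ⊢⇒⟶ (iaxA a m) = axA a m (here refl)
  ⊢⇒⟶ (i⊥R d) = ⊥R (⊢⇒⟶ d)
  ⊢⇒⟶ (i∧L m d) = at-front m λ π → ∧L (exch (prep _ (prep _ π)) ↭-refl (⊢⇒⟶ d))
  ⊢⇒⟶ (i∧R d e) = ∧R (⊢⇒⟶ d) (⊢⇒⟶ e)
  ⊢⇒⟶ (i∨L m d e) = contractL-∈ m (∨L (⊢⇒⟶ d) (⊢⇒⟶ e))
  ⊢⇒⟶ (i∨R₁ d) = ∨R₁ (⊢⇒⟶ d)
  ⊢⇒⟶ (i∨R₂ d) = ∨R₂ (⊢⇒⟶ d)
  ⊢⇒⟶ (i⊃L m d e) = contractL-∈ m (⊃L (⊢⇒⟶ d) (⊢⇒⟶ e))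
  ⊢⇒⟶ (i⊃R d) = ⊃R (⊢⇒⟶ d)
  ⊢⇒⟶ (i∀L t m d) = at-front m λ π → ∀L t (exch (prep _ π) ↭-refl (⊢⇒⟶ d))
  ⊢⇒⟶ (i∃R t d) = ∃R t (⊢⇒⟶ d)
  ⊢⇒⟶ (i∃L c m fr d) = contractL-∈ m (∃L c (Fresh-∷ˡ m fr) (⊢⇒⟶ d))

  ⊢⇒⟶-IsI : (d : C ⊢ Y) → IsI (⊢⇒⟶ d)
  ⊢⇒⟶-IsI iax⊤ = refl , tt
  ⊢⇒⟶-IsI (iaxA _ _) = refl , tt
  ⊢⇒⟶-IsI (i⊥R d) = refl , ⊢⇒⟶-IsI d
  ⊢⇒⟶-IsI (i∧L _ d) = refl , refl , refl , ⊢⇒⟶-IsI d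
  ⊢⇒⟶-IsI (i∧R d e) = refl , ⊢⇒⟶-IsI d , ⊢⇒⟶-IsI e
  ⊢⇒⟶-IsI (i∨L _ d e) = refl , refl , refl , refl , ⊢⇒⟶-IsI d , ⊢⇒⟶-IsI e
  ⊢⇒⟶-IsI (i∨R₁ d) = refl , ⊢⇒⟶-IsI d
  ⊢⇒⟶-IsI (i∨R₂ d) = refl , ⊢⇒⟶-IsI d
  ⊢⇒⟶-IsI (i⊃L _ d e) = refl , refl , refl , refl , ⊢⇒⟶-IsI d , ⊢⇒⟶-IsI e
  ⊢⇒⟶-IsI (i⊃R d) = refl , ⊢⇒⟶-IsI d
  ⊢⇒⟶-IsI (i∀L _ _ d) = refl , refl , refl , ⊢⇒⟶-IsI d
  ⊢⇒⟶-IsI (i∃R _ d) = refl , ⊢⇒⟶-IsI d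
  ⊢⇒⟶-IsI (i∃L _ _ _ d) = refl , refl , refl , refl , ⊢⇒⟶-IsI d

  ⊢⇒⊢I : C ⊢ Y → C ⊢I Y
  ⊢⇒⊢I d = ⊢⇒⟶ d , ⊢⇒⟶-IsI d

  -- Refutation semantics

  Inconsistent : List (Fm 0) → Set
  Inconsistent C = ∀ Y → C ⊢ Y

  -- Quantifying over all extensions makes forcing monotone without a weakening lemma for _⊢_.
  Forces : List (Fm 0) → Fm 0 → Set
  Forces C F = ∀ {C'} → C ⊆ C' → C' ⊢ F

  Refutes : List (Fm 0) → Fm 0 → Set
  Refutes C F = ∀ {C'} → C ⊆ C' → Forces C' F → Inconsistent C'

  refutes-mono : C ⊆ C' → Refutes C F → Refutes C' F
  refutes-mono sub r sub' = r (⊆-trans sub sub')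

  refutes-⊥ : Refutes C `⊥
  refutes-⊥ _ k _ = i⊥R (k ⊆-refl)

  refutes-∨ˡ : Refutes C (A `∨ B) → Refutes C A
  refutes-∨ˡ r sub k = r sub λ sub' → i∨R₁ (k sub')

  refutes-∨ʳ : Refutes C (A `∨ B) → Refutes C B
  refutes-∨ʳ r sub k = r sub λ sub' → i∨R₂ (k sub')

  refutes-∧ʳ : Forces C A → Refutes C (A `∧ B) → Refutes C B
  refutes-∧ʳ kA r sub kB = r sub λ sub' → i∧R (kA (⊆-trans sub sub')) (kB sub')

  refutes-⊃ʳ : Refutes C (A `⊃ B) → Refutes (A ∷ C) B
  refutes-⊃ʳ r sub kB = r (sub ∘ there) λ sub' → i⊃R (kB (there ∘ sub'))

  refutes-∃ : ∀ {B} t → Refutes C (`∃ B) → Refutes C ([ t /x] B)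
  refutes-∃ t r sub k = r sub λ sub' → i∃R t (k sub')

  refutes-antecedent : (A `⊃ B) ∈ C → (∀ {C'} → C ⊆ C' → Inconsistent (B ∷ C')) → Refutes C A
  refutes-antecedent m h sub kA Y = i⊃L (sub m) (kA there) (h sub Y)

  refutes-negated : (A `⊃ `⊥) ∈ C → Refutes C A
  refutes-negated m = refutes-antecedent m λ _ _ → i⊥R (iaxA is⊥ (here refl))

  refutation-sound : Π ⟶ Δ → All IsD Π → All IsG Δ
                   → ∀ σ → Π ⊆[ σ ] C → All (Refutes C ∘ renF σ) Δ → Inconsistent C
  refutation-sound (ax⊤ m) _ _ σ _ rf = All.lookup rf m ⊆-refl λ _ → iax⊤
  refutation-sound (axA a m₁ m₂) _ _ σ mem rf =
    All.lookup rf m₂ ⊆-refl λ sub → iaxA (AtomOr⊥-renF σ a) (sub (All.lookup mem m₁))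
  refutation-sound (exch π₁ π₂ p) dΠ gΔ σ mem rf =
    refutation-sound p (All-resp-↭ (↭-sym π₁) dΠ) (All-resp-↭ (↭-sym π₂) gΔ) σ
                       (All-resp-↭ (↭-sym π₁) mem) (All-resp-↭ (↭-sym π₂) rf)
  refutation-sound (contrL p) (d ∷ dΠ) gΔ σ (m ∷ mem) rf =
    refutation-sound p (d ∷ d ∷ dΠ) gΔ σ (m ∷ m ∷ mem) rf
  refutation-sound (contrR p) dΠ (g ∷ gΔ) σ mem (r ∷ rf) =
    refutation-sound p dΠ (g ∷ g ∷ gΔ) σ mem (r ∷ r ∷ rf)
  refutation-sound (⊥R p) dΠ (_ ∷ gΔ) σ mem (_ ∷ rf) =
    refutation-sound p dΠ (g⊥ ∷ gΔ) σ mem (refutes-⊥ ∷ rf)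
  refutation-sound (∧L p) dΠ@(d∧ d e ∷ _) gΔ σ mem@(m ∷ _) rf Y =
    i∧L m (refutation-sound p (d ∷ e ∷ dΠ) gΔ σ (⊆[]-∷⁺ refl (⊆[]-∷⁺ refl mem))
                            (All.map (refutes-mono (there ∘ there)) rf) Y)
  refutation-sound (∧R {B = B} p q) dΠ (g∧ g h ∷ gΔ) σ mem (r ∷ rf) =
    refutation-sound p dΠ (g ∷ gΔ) σ mem (refutes-B ∷ rf)
    where
    refutes-B : Refutes _ (renF σ B)
    refutes-B sub kB = refutation-sound q dΠ (h ∷ gΔ) σ (⊆[]-mono sub mem)
                         (refutes-∧ʳ kB (refutes-mono sub r) ∷ All.map (refutes-mono sub) rf)
  refutation-sound (∨L p q) (d∨ d e ∷ dΓ) gΔ σ (m ∷ mem) rf Y =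
    i∨L m (refutation-sound p (d ∷ dΓ) gΔ σ (⊆[]-∷⁺ refl mem) (All.map (refutes-mono there) rf) Y)
          (refutation-sound q (e ∷ dΓ) gΔ σ (⊆[]-∷⁺ refl mem) (All.map (refutes-mono there) rf) Y)
  refutation-sound (∨R₁ p) dΠ (g∨ g _ ∷ gΔ) σ mem (r ∷ rf) =
    refutation-sound p dΠ (g ∷ gΔ) σ mem (refutes-∨ˡ r ∷ rf)
  refutation-sound (∨R₂ p) dΠ (g∨ _ h ∷ gΔ) σ mem (r ∷ rf) =
    refutation-sound p dΠ (h ∷ gΔ) σ mem (refutes-∨ʳ r ∷ rf)
  refutation-sound (⊃L {Δ = Δ₁} p q) dΠ@(d⊃ g e ∷ dΓ) gΔ σ mem@(m ∷ memΓ) rf =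
    refutation-sound p dΠ (g ∷ ++⁻ˡ Δ₁ gΔ) σ mem (refutes-antecedent m inconsistent-D ∷ ++⁻ˡ Δ₁ rf)
    where
    inconsistent-D : ∀ {C'} → _ ⊆ C' → Inconsistent (_ ∷ C')
    inconsistent-D sub = refutation-sound q (e ∷ dΓ) (++⁻ʳ Δ₁ gΔ) σ (⊆[]-∷⁺ refl (⊆[]-mono sub memΓ))
                           (All.map (refutes-mono (there ∘ sub)) (++⁻ʳ Δ₁ rf))
  refutation-sound (⊃R p) dΠ (g⊃ d h ∷ gΔ) σ mem (r ∷ rf) =
    r ⊆-refl λ sub → i⊃R (refutation-sound p (d ∷ dΠ) (h ∷ gΔ) σ (⊆[]-∷⁺ refl (⊆[]-mono sub mem))
                            (refutes-⊃ʳ (refutes-mono sub r) ∷ All.map (refutes-mono (there ∘ sub)) rf) _)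
  refutation-sound (∀L {B = B} t p) dΠ@(d∀ d ∷ _) gΔ σ mem@(m ∷ _) rf Y =
    i∀L (renT σ t) m (refutation-sound p (IsD-instF t d ∷ dΠ) gΔ σ (⊆[]-∷⁺ (renF-instF σ t B) mem)
                                       (All.map (refutes-mono there) rf) Y)
  refutation-sound (∃R {B = B} t p) dΠ (g∃ g ∷ gΔ) σ mem (r ∷ rf) =
    refutation-sound p dΠ (IsG-instF t g ∷ gΔ) σ mem
      (subst (Refutes _) (sym (renF-instF σ t B)) (refutes-∃ (renT σ t) r) ∷ rf)
  refutation-sound {C = C} (∃L {B = B} c (frB ∷ frΓ , frΔ) p) (d∃ d ∷ dΓ) gΔ σ (m ∷ mem) rf Y
    with fresh C (Y ∷ [])
  ... | c' , fr' =
    i∃L c' m fr' (refutation-sound p (IsD-instF (con c) d ∷ dΓ) gΔ (σ [ c ↦ c' ])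
                    (⊆[]-∷⁺ (renF-eigen σ c' B frB) (All-renF-↦-fresh (_∈ _) σ c' frΓ mem))
                    (All.map (refutes-mono there) (All-renF-↦-fresh (Refutes _) σ c' frΔ rf)) Y)
  refutation-sound (∀R _ _ _) _ (() ∷ _)

theorem1 : (S : Signature) (Γ : List (Logic.Fm S 0)) (G : Logic.Fm S 0)
    → All (Logic.IsD S) Γ → Logic.IsG S G
    → Logic._⊢C_ S Γ G ⇔ Logic._⊢I_ S (Logic._`⊃_ G Logic.`⊥ ∷ Γ) G
theorem1 S Γ G dΓ gG = mk⇔ classical⇒intuitionistic intuitionistic⇒classical
  where
  open Logic S
  open Glivenko S

  ¬G∷Γ-inconsistent : Γ ⊢C G → Inconsistent ((G `⊃ `⊥) ∷ Γ)
  ¬G∷Γ-inconsistent p = refutation-sound p dΓ (gG ∷ []) id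
    (All-renF-id (_∈ _) (All.tabulate there)) (All-renF-id (Refutes _) (refutes-negated (here refl) ∷ []))

  classical⇒intuitionistic : Γ ⊢C G → ((G `⊃ `⊥) ∷ Γ) ⊢I G
  classical⇒intuitionistic p = ⊢⇒⊢I (¬G∷Γ-inconsistent p G)

  intuitionistic⇒classical : ((G `⊃ `⊥) ∷ Γ) ⊢I G → Γ ⊢C G
  intuitionistic⇒classical (p , _) =
    discharge p id (All-renF-id (_∈ _) (All.tabulate id)) (All-renF-id (_∈ _) (here refl ∷ [])) (here refl)
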